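{- Let $\mathcal{T}$ be a complete context tree over $A$ of depth $\ell$, and let $r_2=n(\overline{\mathcal{T}})/n(\mathcal{T})$. Then $1\le r_2\le\ell$.
   Context: Fix a finite alphabet $A=\{a_1,\dots,a_n\}$. Strings are finite sequences (possibly empty) of letters of $A$; $\overline{uv}$ is concatenation; $v\prec s$ ($v$ is a postfix of $s$) if $s=\overline{wv}$ for some string $w$. A context tree over $A$ is a finite rooted tree whose non-root vertices are labeled by letters of $A$, no two siblings having the same label; a context is the string read along the path from a leaf to the root (leaf's label first), and $\mathcal{T}^*$ is the set of contexts. $\mathcal{T}$ is complete if every node is a leaf or has exactly $n$ children. The depth $\ell$ of $\mathcal{T}$ is the maximal length of a context. $n(\mathcal{T})$ denotes the number of leaves of $\mathcal{T}$ (i.e. $|\mathcal{T}^*|$). $\mathcal{A}\subseteq\mathcal{B}$ ("contained at the root") means every $a\in\mathcal{A}^*$ satisfies $a\prec b$ for some $b\in\mathcal{B}^*$. $\mathcal{T}$ has perfect memory if for every $c\in\mathcal{T}^*$ and every $i$ there exists $u\in\mathcal{T}^*$ with $u\prec\overline{ca_i}$. The perfect-memory closure $\overline{\mathcal{T}}$ is the smallest (with respect to $\subseteq$) perfect-memory context tree containing $\mathcal{T}$. -}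

module Defs where

open import Data.Nat using (ℕ; _⊔_)
open import Data.Fin using (Fin)
open import Data.Bool using (Bool; true; false; if_then_else_)
open import Data.Maybe using (Maybe; just; nothing; is-nothing)
open import Data.List using (List; []; _∷_; [_]; _++_; _∷ʳ_; map; concatMap; length; foldr; allFin)
open import Data.List.Membership.Propositional using (_∈_)
open import Data.Product using (Σ; ∃; _×_)
open import Relation.Binary.PropositionalEquality using (_≡_)

_≺_ : ∀ {n} → List (Fin n) → List (Fin n) → Set
v ≺ s = ∃ λ w → s ≡ w ++ v

-- A context tree: a rooted tree each of whose nodes has, for each letter a,
-- at most one child labelled a (so siblings have distinct labels).
-- Inductive, hence finite.
data Tree (n : ℕ) : Set where
  node : (Fin n → Maybe (Tree n)) → Tree n

isLeaf : ∀ {n} → (Fin n → Maybe (Tree n)) → Bool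
isLeaf {n} ch = foldr (λ a b → if is-nothing (ch a) then b else false) true (allFin n)

-- The contexts (one per leaf): strings read from leaf to root,
-- leaf's label first, the label of the root's child last.
mutual
  contexts : ∀ {n} → Tree n → List (List (Fin n))
  contexts {n} (node ch) =
    if isLeaf ch then [ [] ] else concatMap (λ a → contextsVia a (ch a)) (allFin n)

  contextsVia : ∀ {n} → Fin n → Maybe (Tree n) → List (List (Fin n))
  contextsVia a nothing  = []
  contextsVia a (just t) = map (λ c → c ∷ʳ a) (contexts t)

numLeaves : ∀ {n} → Tree n → ℕ
numLeaves t = length (contexts t)

depth : ∀ {n} → Tree n → ℕ
depth t = foldr _⊔_ 0 (map length (contexts t))

data Complete {n : ℕ} : Tree n → Set where
  leaf : ∀ {ch} → (∀ a → ch a ≡ nothing) → Complete (node ch)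
  full : ∀ {ch} → (∀ a → ∃ λ t → ch a ≡ just t × Complete t) → Complete (node ch)

_⊑_ : ∀ {n} → Tree n → Tree n → Set
𝒜 ⊑ ℬ = ∀ {a} → a ∈ contexts 𝒜 → ∃ λ b → b ∈ contexts ℬ × a ≺ b

PerfectMemory : ∀ {n} → Tree n → Set
PerfectMemory {n} t =
  ∀ {c} → c ∈ contexts t → (i : Fin n) → ∃ λ u → u ∈ contexts t × u ≺ (c ∷ʳ i)

IsPMClosure : ∀ {n} → Tree n → Tree n → Set
IsPMClosure {n} t c =
  PerfectMemory c × t ⊑ c × ((d : Tree n) → PerfectMemory d → t ⊑ d → c ⊑ d)

-- The contexts of a context tree form an antichain for ≺ (no context is a proper postfix of
-- another), and two members of an antichain are never postfixes of a common word, so T ⊑ C maps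
-- the contexts of T injectively into those of C.  For the upper bound let Interior T be the set
-- of words x such that b ∷ x occurs inside a context of T for some letter b.  It is closed under
-- deleting the first or the last letter, hence it is the set of internal nodes of a
-- perfect-memory tree D ⊒ T whose contexts are the words a ∷ x with x interior and a ∷ x not.
-- If x occurs in the context y ++ b ∷ x ++ g, completeness yields a context comparable with
-- a ∷ x ++ g; it cannot be a proper postfix of y ++ b ∷ x ++ g, so it is z ++ a ∷ x ++ g and
-- a ∷ x is a postfix of a nonempty prefix of a context.  Minimality gives C ⊑ D, so every context
-- of C is a postfix of one of the ℓ · n(T) words take k t (1 ≤ k ≤ ℓ, t a context of T), and the
-- antichain argument bounds n(C) by ℓ · n(T).
module Submission where

open import Defs
open import Data.Nat using (ℕ; zero; suc; _+_; _≤_; _<_; _*_; _⊔_; z≤n; s≤s)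
open import Data.Nat.Properties
  using (≤-trans; ≤-reflexive; <⇒≱; m≤n+m; m≤m+n; m≤m⊔n; m≤n⊔m; +-suc; ⊔-sel; module ≤-Reasoning)
open import Data.Fin using (Fin) renaming (_≟_ to _≟ᶠ_)
import Data.Fin.Properties as Fin
open import Data.Bool using (Bool; true; false; if_then_else_)
open import Data.Maybe using (Maybe; just; nothing; is-nothing)
open import Data.Maybe.Properties using (just-injective)
open import Data.List
  using (List; []; _∷_; [_]; _++_; _∷ʳ_; map; concatMap; length; foldr; allFin; take;
         applyUpTo; cartesianProductWith)
open import Data.List.Properties
  using (length-++; length-++-sucʳ; length-map; length-applyUpTo; ++-assoc; ++-identityʳ;
         ++-identityˡ-unique; ++-conicalʳ; ∷ʳ-injective; ∷ʳ-injectiveˡ; ∷-injectiveʳ)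
open import Data.List.Reverse using ([]; _∶_∶ʳ_; reverseView)
open import Data.List.Membership.Propositional using (_∈_; find; lose)
open import Data.List.Membership.Propositional.Properties
  using (∈-∃++; ∈-++⁻; ∈-++⁺ˡ; ∈-++⁺ʳ; ∈-map⁻; ∈-map⁺; ∈-concatMap⁻; ∈-concatMap⁺; ∈-allFin;
         ∈-applyUpTo⁺; ∈-cartesianProductWith⁺)
open import Data.List.Relation.Unary.Any using (Any; here; there; any?)
import Data.List.Relation.Unary.Any as Any
import Data.List.Relation.Unary.All as All
import Data.List.Relation.Unary.All.Properties as All
import Data.List.Relation.Unary.AllPairs as AllPairs
import Data.List.Relation.Unary.AllPairs.Properties as AllPairs
open import Data.List.Relation.Unary.AllPairs using ([]; _∷_)
open import Data.List.Relation.Unary.Unique.Propositional using (Unique)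
import Data.List.Relation.Unary.Unique.Propositional.Properties as Unique
open import Data.List.Relation.Binary.Pointwise using (Pointwise-≡⇒≡)
import Data.List.Relation.Binary.Pointwise.Properties as Pointwise
open import Data.List.Relation.Binary.Prefix.Heterogeneous using ([]; _∷_)
import Data.List.Relation.Binary.Prefix.Heterogeneous as Prefix
open import Data.List.Relation.Binary.Suffix.Heterogeneous using (Suffix)
open import Data.List.Relation.Binary.Infix.Heterogeneous using (Infix; here; there; MkView; toView)
open import Data.List.Relation.Binary.Infix.Heterogeneous.Properties
  using (infix?; length-mono; fromPointwise; Prefix-Infix-trans; Suffix-Infix-trans)
open import Data.Product using (∃; ∃₂; _×_; _,_; proj₁; proj₂)
open import Data.Sum using (_⊎_; inj₁; inj₂; [_,_]′)
import Data.Sum as Sum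
open import Function using (_∘_)
open import Relation.Nullary using (¬_; does; yes; no; contradiction)
open import Relation.Unary using (Decidable)
open import Relation.Binary.PropositionalEquality
  using (_≡_; _≢_; refl; sym; trans; cong; cong₂; subst; module ≡-Reasoning)

Word : ℕ → Set
Word n = List (Fin n)

Children : ℕ → Set
Children n = Fin n → Maybe (Tree n)

∈-++-∷⁻ : {A : Set} (as : List A) {a b : A} {bs : List A} → a ∈ as ++ b ∷ bs → a ≡ b ⊎ a ∈ as ++ bs
∈-++-∷⁻ as a∈ with ∈-++⁻ as a∈
... | inj₁ a∈as         = inj₂ (∈-++⁺ˡ a∈as)
... | inj₂ (here a≡b)   = inj₁ a≡b
... | inj₂ (there a∈bs) = inj₂ (∈-++⁺ʳ as a∈bs)

module _ {A B : Set} where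

  length≤-by-injection : (R : A → B → Set) {xs : List A} {ys : List B} → Unique xs →
    (∀ {x} → x ∈ xs → ∃ λ y → y ∈ ys × R x y) →
    (∀ {x x′ y} → x ∈ xs → x′ ∈ xs → R x y → R x′ y → x ≡ x′) →
    length xs ≤ length ys
  length≤-by-injection R {[]} _ _ _ = z≤n
  length≤-by-injection R {x ∷ xs} (x∉xs ∷ unique) image injective
    with y , y∈ys , Rxy ← image (here refl)
    with as , bs , refl ← ∈-∃++ y∈ys =
    ≤-trans (s≤s (length≤-by-injection R unique image′ (λ p q → injective (there p) (there q))))
            (≤-reflexive (sym (length-++-sucʳ as y bs)))
    where
    image′ : ∀ {x′} → x′ ∈ xs → ∃ λ y′ → y′ ∈ as ++ bs × R x′ y′
    image′ x′∈xs with y′ , y′∈ , Rx′y′ ← image (there x′∈xs) with ∈-++-∷⁻ as y′∈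
    ... | inj₂ y′∈as++bs = y′ , y′∈as++bs , Rx′y′
    ... | inj₁ refl      =
      contradiction (injective (here refl) (there x′∈xs) Rxy Rx′y′) (All.lookup x∉xs x′∈xs)

  length-cartesianProductWith : ∀ {C : Set} (f : A → B → C) xs ys →
    length (cartesianProductWith f xs ys) ≡ length xs * length ys
  length-cartesianProductWith f []       ys = refl
  length-cartesianProductWith f (x ∷ xs) ys = begin
    length (map (f x) ys ++ cartesianProductWith f xs ys)  ≡⟨ length-++ (map (f x) ys) ⟩
    length (map (f x) ys) + length (cartesianProductWith f xs ys)
      ≡⟨ cong₂ _+_ (length-map (f x) ys) (length-cartesianProductWith f xs ys) ⟩
    length ys + length xs * length ys                        ∎
    where open ≡-Reasoning

module _ {A : Set} where

  take-length-++ : ∀ (xs ys : List A) → take (length xs) (xs ++ ys) ≡ xs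
  take-length-++ []       ys = refl
  take-length-++ (x ∷ xs) ys = cong (x ∷_) (take-length-++ xs ys)

  ≤-foldr-⊔ : (f : A → ℕ) {x : A} {xs : List A} → x ∈ xs → f x ≤ foldr _⊔_ 0 (map f xs)
  ≤-foldr-⊔ f {xs = y ∷ ys} (here refl) = m≤m⊔n (f y) _
  ≤-foldr-⊔ f {xs = y ∷ ys} (there x∈ys) = ≤-trans (≤-foldr-⊔ f x∈ys) (m≤n⊔m (f y) _)

  foldr-⊔-positive : (f : A → ℕ) (xs : List A) → 0 < foldr _⊔_ 0 (map f xs) → ∃ λ x → x ∈ xs × 0 < f x
  foldr-⊔-positive f (y ∷ ys) pos with ⊔-sel (f y) (foldr _⊔_ 0 (map f ys))
  ... | inj₁ ≡fy   = y , here refl , subst (0 <_) ≡fy pos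
  ... | inj₂ ≡rest with x , x∈ys , fx>0 ← foldr-⊔-positive f ys (subst (0 <_) ≡rest pos) =
    x , there x∈ys , fx>0

  Infix-∷⁻ : ∀ {a : A} {as bs} → Infix _≡_ (a ∷ as) bs → Infix _≡_ as bs
  Infix-∷⁻ = Suffix-Infix-trans trans (Suffix.there (Suffix.here (Pointwise.refl refl)))

  Infix-∷ʳ⁻ : ∀ {a : A} {as bs} → Infix _≡_ (as ∷ʳ a) bs → Infix _≡_ as bs
  Infix-∷ʳ⁻ {a} = Prefix-Infix-trans trans (Prefix.fromView (Prefix._++_ (Pointwise.refl refl) [ a ]))

  Infix⇒∃++ : ∀ {as bs : List A} → Infix _≡_ as bs → ∃₂ λ ys zs → bs ≡ ys ++ as ++ zs
  Infix⇒∃++ i with MkView ys pw zs ← toView i rewrite Pointwise-≡⇒≡ pw = ys , zs , refl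

nonemptyPrefixes : {A : Set} → ℕ → List (List A) → List (List A)
nonemptyPrefixes ℓ = cartesianProductWith take (applyUpTo suc ℓ)

length-nonemptyPrefixes : {A : Set} (ℓ : ℕ) (ts : List (List A)) →
  length (nonemptyPrefixes ℓ ts) ≡ ℓ * length ts
length-nonemptyPrefixes ℓ ts =
  trans (length-cartesianProductWith take (applyUpTo suc ℓ) ts)
        (cong (_* length ts) (length-applyUpTo suc ℓ))

∈-nonemptyPrefixes : {A : Set} {ℓ : ℕ} {ts : List (List A)} {p g : List A} →
  p ++ g ∈ ts → length (p ++ g) ≤ ℓ → 0 < length p → p ∈ nonemptyPrefixes ℓ ts
∈-nonemptyPrefixes {ℓ = ℓ} {ts} {a ∷ p} {g} t∈ts |t|≤ℓ _ =
  subst (_∈ nonemptyPrefixes ℓ ts) (take-length-++ (a ∷ p) g)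
    (∈-cartesianProductWith⁺ take {ys = ts} (∈-applyUpTo⁺ suc |a∷p|≤ℓ) t∈ts)
  where
  |a∷p|≤ℓ : length (a ∷ p) ≤ ℓ
  |a∷p|≤ℓ = ≤-trans (m≤m+n (length (a ∷ p)) (length g)) (subst (_≤ ℓ) (length-++ (a ∷ p)) |t|≤ℓ)

-- Postfixes and antichains

module _ {n : ℕ} where

  ≺-refl : {u : Word n} → u ≺ u
  ≺-refl = [] , refl

  ≺-trans : {u v w : Word n} → u ≺ v → v ≺ w → u ≺ w
  ≺-trans {u} (x , refl) (y , refl) = y ++ x , sym (++-assoc y x u)

  []≺ : (u : Word n) → [] ≺ u
  []≺ u = u , sym (++-identityʳ u)

  ≺-∷ʳ⁺ : {u v : Word n} (a : Fin n) → u ≺ v → (u ∷ʳ a) ≺ (v ∷ʳ a)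
  ≺-∷ʳ⁺ {u} a (w , refl) = w , ++-assoc w u [ a ]

  ≺-∷ʳ⁻ : {u v : Word n} {a b : Fin n} → (u ∷ʳ a) ≺ (v ∷ʳ b) → a ≡ b × u ≺ v
  ≺-∷ʳ⁻ {u} {v} {a} (w , eq) with v≡wu , b≡a ← ∷ʳ-injective v (w ++ u) (trans eq (sym (++-assoc w u [ a ]))) =
    sym b≡a , w , v≡wu

  ≺⇒length≤ : {u v : Word n} → u ≺ v → length u ≤ length v
  ≺⇒length≤ {u} (w , refl) = ≤-trans (m≤n+m (length u) (length w)) (≤-reflexive (sym (length-++ w)))

  ≺-connex-below : {u v w : Word n} → u ≺ w → v ≺ w → u ≺ v ⊎ v ≺ u
  ≺-connex-below {u} {v} (x , w≡xu) (y , w≡yv) = go x y (trans (sym w≡xu) w≡yv)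
    where
    go : ∀ x y → x ++ u ≡ y ++ v → u ≺ v ⊎ v ≺ u
    go []      y       eq = inj₂ (y , eq)
    go (a ∷ x) []      eq = inj₁ (a ∷ x , sym eq)
    go (a ∷ x) (b ∷ y) eq = go x y (∷-injectiveʳ eq)

  Antichain : List (Word n) → Set
  Antichain us = ∀ {u v} → u ∈ us → v ∈ us → u ≺ v → u ≡ v

  antichain-length≤ : {us vs : List (Word n)} → Unique us → Antichain us →
    (∀ {u} → u ∈ us → ∃ λ v → v ∈ vs × u ≺ v) → length us ≤ length vs
  antichain-length≤ unique antichain cover = length≤-by-injection _≺_ unique cover
    λ u∈ u′∈ u≺v u′≺v → [ antichain u∈ u′∈ , sym ∘ antichain u′∈ u∈ ]′ (≺-connex-below u≺v u′≺v)

-- Context trees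

module _ {n : ℕ} where

  private
    noChildAmong : Children n → List (Fin n) → Bool
    noChildAmong ch = foldr (λ a b → if is-nothing (ch a) then b else false) true

    childless⇒noChildAmong : ∀ {ch : Children n} → (∀ a → ch a ≡ nothing) → ∀ as → noChildAmong ch as ≡ true
    childless⇒noChildAmong none []       = refl
    childless⇒noChildAmong none (a ∷ as) rewrite none a = childless⇒noChildAmong none as

    child⇒¬noChildAmong : ∀ {ch : Children n} {a t as} → a ∈ as → ch a ≡ just t → noChildAmong ch as ≡ false
    child⇒¬noChildAmong {ch} {as = b ∷ as} (here refl) child rewrite child = refl
    child⇒¬noChildAmong {ch} {as = b ∷ as} (there a∈as) child with ch b
    ... | just _  = refl
    ... | nothing = child⇒¬noChildAmong a∈as child

    ¬noChildAmong⇒child : ∀ {ch : Children n} as → noChildAmong ch as ≡ false → ∃₂ λ a t → ch a ≡ just t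
    ¬noChildAmong⇒child {ch} (a ∷ as) eq with ch a in child
    ... | just t  = a , t , child
    ... | nothing = ¬noChildAmong⇒child as eq

  childless⇒isLeaf : ∀ {ch : Children n} → (∀ a → ch a ≡ nothing) → isLeaf ch ≡ true
  childless⇒isLeaf none = childless⇒noChildAmong none (allFin n)

  child⇒¬isLeaf : ∀ {ch : Children n} {a t} → ch a ≡ just t → isLeaf ch ≡ false
  child⇒¬isLeaf {a = a} = child⇒¬noChildAmong (∈-allFin a)

  ¬isLeaf⇒child : ∀ {ch : Children n} → isLeaf ch ≡ false → ∃₂ λ a t → ch a ≡ just t
  ¬isLeaf⇒child = ¬noChildAmong⇒child (allFin n)

  childContexts : Children n → List (Word n)
  childContexts ch = concatMap (λ a → contextsVia a (ch a)) (allFin n)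

  contexts-internal : ∀ {ch : Children n} → isLeaf ch ≡ false → contexts (node ch) ≡ childContexts ch
  contexts-internal not-leaf rewrite not-leaf = refl

  ∈-contextsVia⁻ : ∀ {a} {m : Maybe (Tree n)} {u : Word n} → u ∈ contextsVia a m →
    ∃₂ λ t r → m ≡ just t × r ∈ contexts t × u ≡ r ∷ʳ a
  ∈-contextsVia⁻ {a} {just t} u∈ with r , r∈ , refl ← ∈-map⁻ (_∷ʳ a) u∈ = t , r , refl , r∈ , refl

  ∈-childContexts⁻ : ∀ {ch : Children n} {u : Word n} → u ∈ childContexts ch →
    ∃ λ a → ∃₂ λ t r → ch a ≡ just t × r ∈ contexts t × u ≡ r ∷ʳ a
  ∈-childContexts⁻ {ch} u∈
    with a , _ , u∈via ← find (∈-concatMap⁻ (λ a → contextsVia a (ch a)) {xs = allFin n} u∈) =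
    a , ∈-contextsVia⁻ u∈via

  ∈-childContexts⁺ : ∀ {ch : Children n} {a t} {r : Word n} → ch a ≡ just t → r ∈ contexts t →
    r ∷ʳ a ∈ childContexts ch
  ∈-childContexts⁺ {ch} {a} {t} {r} child r∈ =
    ∈-concatMap⁺ (λ b → contextsVia b (ch b)) (lose (∈-allFin a) (via child))
    where
    via : ∀ {m} → m ≡ just t → r ∷ʳ a ∈ contextsVia a m
    via refl = ∈-map⁺ (_∷ʳ a) r∈

  ∈-contexts-child⁺ : ∀ {ch : Children n} {a t} {r : Word n} → ch a ≡ just t → r ∈ contexts t →
    r ∷ʳ a ∈ contexts (node ch)
  ∈-contexts-child⁺ {ch} child r∈ =
    subst (_ ∈_) (sym (contexts-internal (child⇒¬isLeaf {ch = ch} child)))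
      (∈-childContexts⁺ {ch = ch} child r∈)

  tree-ind : (P : Tree n → Set) → (∀ {ch : Children n} → (∀ {a t} → ch a ≡ just t → P t) → P (node ch)) →
    ∀ t → P t
  tree-ind P step (node ch) = step λ {a} → below (ch a)
    where
    below : (m : Maybe (Tree n)) → ∀ {t} → m ≡ just t → P t
    below (just t) refl = tree-ind P step t

  contexts-antichain : (t : Tree n) → Antichain (contexts t)
  contexts-antichain = tree-ind (Antichain ∘ contexts) step
    where
    step : ∀ {ch : Children n} → (∀ {a t} → ch a ≡ just t → Antichain (contexts t)) →
      Antichain (contexts (node ch))
    -- Abstracting isLeaf ch also reduces contexts (node ch) in the types of u∈ and v∈.
    step {ch} ih u∈ v∈ u≺v with isLeaf ch
    ... | true  with here refl ← u∈ with here refl ← v∈ = refl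
    ... | false
      with a , t , r , child , r∈ , refl ← ∈-childContexts⁻ {ch = ch} u∈
         | b , t′ , r′ , child′ , r′∈ , refl ← ∈-childContexts⁻ {ch = ch} v∈
      with refl , r≺r′ ← ≺-∷ʳ⁻ u≺v
      with refl ← just-injective (trans (sym child) child′) =
      cong (_∷ʳ a) (ih child r∈ r′∈ r≺r′)

  contexts-unique : (t : Tree n) → Unique (contexts t)
  contexts-unique = tree-ind (Unique ∘ contexts) step
    where
    step : ∀ {ch : Children n} → (∀ {a t} → ch a ≡ just t → Unique (contexts t)) →
      Unique (contexts (node ch))
    step {ch} ih with isLeaf ch
    ... | true  = All.[] ∷ []
    ... | false = Unique.concat⁺ (All.map⁺ (All.universal viaUnique (allFin n)))
                                 (AllPairs.map⁺ (AllPairs.map viaDisjoint (Unique.allFin⁺ n)))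
      where
      viaUnique : ∀ a → Unique (contextsVia a (ch a))
      viaUnique a with ch a in child
      ... | nothing = []
      ... | just t  = Unique.map⁺ (∷ʳ-injectiveˡ _ _) (ih child)
      viaDisjoint : ∀ {a b} → a ≢ b → ∀ {u} → ¬ (u ∈ contextsVia a (ch a) × u ∈ contextsVia b (ch b))
      viaDisjoint {a} {b} a≢b (u∈a , u∈b)
        with _ , r , _ , _ , u≡ra ← ∈-contextsVia⁻ {m = ch a} u∈a
           | _ , r′ , _ , _ , u≡r′b ← ∈-contextsVia⁻ {m = ch b} u∈b =
        a≢b (proj₂ (∷ʳ-injective r r′ (trans (sym u≡ra) u≡r′b)))

  numLeaves-mono-⊑ : {A B : Tree n} → A ⊑ B → numLeaves A ≤ numLeaves B
  numLeaves-mono-⊑ {A} = antichain-length≤ (contexts-unique A) (contexts-antichain A)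

  Comparable : Tree n → Word n → Set
  Comparable t w = ∃ λ u → u ∈ contexts t × (u ≺ w ⊎ w ≺ u)

  Complete⇒comparable : ∀ {t : Tree n} → Complete t → ∀ w → Comparable t w
  Complete⇒comparable (leaf none) w rewrite childless⇒isLeaf none = [] , here refl , inj₁ ([]≺ w)
  Complete⇒comparable (full kids) w with reverseView w
  ... | w′ ∶ _ ∶ʳ a with t , child , complete ← kids a
                     with u , u∈ , comparable ← Complete⇒comparable complete w′ =
    u ∷ʳ a , ∈-contexts-child⁺ child u∈ , Sum.map (≺-∷ʳ⁺ a) (≺-∷ʳ⁺ a) comparable
  Complete⇒comparable {node ch} (full kids) w | [] with isLeaf ch in leaf?
  ... | true  = [] , here refl , inj₁ ≺-refl
  ... | false with a , _ ← ¬isLeaf⇒child leaf?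
              with t , child , complete ← kids a
              with u , u∈ , _ ← Complete⇒comparable complete [] =
    u ∷ʳ a , ∈-childContexts⁺ {ch = ch} child u∈ , inj₂ ([]≺ _)

-- A tree is described by its internal nodes, each named by the word read from it up to the root.
-- The letter a₀ only witnesses a nonempty alphabet: over Fin 0 a node with all children is a leaf.
module TreeWithInternalNodes {n : ℕ} (Internal : Word n → Set) (internal? : Decidable Internal)
  (Internal-∷⁻ : ∀ {a x} → Internal (a ∷ x) → Internal x) (Internal-[] : Internal [])
  (ℓ : ℕ) (Internal⇒length< : ∀ {x} → Internal x → length x < ℓ) (a₀ : Fin n) where

  Leaf : Word n → Set
  Leaf u = ∃₂ λ a x → u ≡ a ∷ x × Internal x × ¬ Internal u

  Internal-++⁻ : ∀ y {x} → Internal (y ++ x) → Internal x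
  Internal-++⁻ []      internal = internal
  Internal-++⁻ (a ∷ y) internal = Internal-++⁻ y (Internal-∷⁻ internal)

  mutual
    subtree : ℕ → Word n → Tree n
    subtree zero    x = node λ _ → nothing
    subtree (suc k) x = node (children k x (does (internal? x)))

    children : ℕ → Word n → Bool → Children n
    children k x true  a = just (subtree k (a ∷ x))
    children k x false a = nothing

  tree : Tree n
  tree = subtree ℓ []

  private
    Fuel : ℕ → Word n → Set
    Fuel k x = ℓ ≤ k + length x

    Fuel-∷ : ∀ {k} x a → Fuel (suc k) x → Fuel k (a ∷ x)
    Fuel-∷ {k} x a fuel = subst (ℓ ≤_) (sym (+-suc k (length x))) fuel

    out-of-fuel : ∀ {x} → Fuel 0 x → ¬ Internal x
    out-of-fuel fuel internal = <⇒≱ (Internal⇒length< internal) fuel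

    leaf-contexts : contexts (node {n} λ _ → nothing) ≡ [ [] ]
    leaf-contexts rewrite childless⇒isLeaf {ch = λ (_ : Fin n) → nothing} (λ _ → refl) = refl

    internal-contexts : ∀ k {x} → Internal x → contexts (subtree (suc k) x) ≡ childContexts (children k x true)
    internal-contexts k {x} internal with internal? x
    ... | yes _        = contexts-internal {ch = children k x true}
                           (child⇒¬isLeaf {ch = children k x true} {a₀} {subtree k (a₀ ∷ x)} refl)
    ... | no  external = contradiction internal external

  subtree-leaf : ∀ k {x} → ¬ Internal x → contexts (subtree k x) ≡ [ [] ]
  subtree-leaf zero    _ = leaf-contexts
  subtree-leaf (suc k) {x} external with internal? x
  ... | yes internal = contradiction internal external
  ... | no  _        = leaf-contexts

  ∈-subtree⁻ : ∀ k {x r} → Fuel k x → Internal x → r ∈ contexts (subtree k x) → Leaf (r ++ x)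
  ∈-subtree⁻ zero    fuel internal _ = contradiction internal (out-of-fuel fuel)
  ∈-subtree⁻ (suc k) {x} fuel internal r∈
    with a , t , r′ , refl , r′∈ , refl
           ← ∈-childContexts⁻ {ch = children k x true} (subst (_ ∈_) (internal-contexts k internal) r∈)
    rewrite ++-assoc r′ [ a ] x
    with internal? (a ∷ x)
  ... | yes internal′ = ∈-subtree⁻ k (Fuel-∷ x a fuel) internal′ r′∈
  ... | no external
    with here refl ← subst (r′ ∈_) (subtree-leaf k external) r′∈ = a , x , refl , internal , external

  leaf-above-external : ∀ {x} r → ¬ Internal x → Leaf (r ++ x) → r ≡ []
  leaf-above-external []      _        _ = refl
  leaf-above-external (c ∷ r) external (_ , _ , refl , internal , _) =
    contradiction (Internal-++⁻ r internal) external

  ∈-subtree⁺ : ∀ k {x r} → Fuel k x → Internal x → Leaf (r ++ x) → r ∈ contexts (subtree k x)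
  ∈-subtree⁺ zero fuel internal _ = contradiction internal (out-of-fuel fuel)
  ∈-subtree⁺ (suc k) {x} {r} fuel internal u-leaf with reverseView r
  ... | [] with _ , _ , _ , _ , external ← u-leaf = contradiction internal external
  ... | r′ ∶ _ ∶ʳ a =
    subst (_ ∈_) (sym (internal-contexts k internal))
      (∈-childContexts⁺ {ch = children k x true} refl (∈-child (subst Leaf (++-assoc r′ [ a ] x) u-leaf)))
    where
    ∈-child : Leaf (r′ ++ a ∷ x) → r′ ∈ contexts (subtree k (a ∷ x))
    ∈-child r′ax-leaf with internal? (a ∷ x)
    ... | yes internal′ = ∈-subtree⁺ k (Fuel-∷ x a fuel) internal′ r′ax-leaf
    ... | no  external
      rewrite leaf-above-external r′ external r′ax-leaf | subtree-leaf k external = here refl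

  ∈-tree⁻ : ∀ {u} → u ∈ contexts tree → Leaf u
  ∈-tree⁻ {u} u∈ = subst Leaf (++-identityʳ u) (∈-subtree⁻ ℓ (m≤m+n ℓ 0) Internal-[] u∈)

  ∈-tree⁺ : ∀ {u} → Leaf u → u ∈ contexts tree
  ∈-tree⁺ {u} u-leaf =
    ∈-subtree⁺ ℓ (m≤m+n ℓ 0) Internal-[] (subst Leaf (sym (++-identityʳ u)) u-leaf)

  postfix-leaf : ∀ w → ¬ Internal w → ∃ λ u → u ∈ contexts tree × u ≺ w
  postfix-leaf []      external = contradiction Internal-[] external
  postfix-leaf (a ∷ x) external with internal? x
  ... | yes internal  = a ∷ x , ∈-tree⁺ (a , x , refl , internal , external) , ≺-refl
  ... | no  external′ with u , u∈ , u≺x ← postfix-leaf x external′ =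
    u , u∈ , ≺-trans u≺x ([ a ] , refl)

  extension-leaf : ∀ {w} → Internal w → ∃ λ u → u ∈ contexts tree × w ≺ u
  extension-leaf {w} = go ℓ (m≤m+n ℓ (length w))
    where
    go : ∀ k {w} → Fuel k w → Internal w → ∃ λ u → u ∈ contexts tree × w ≺ u
    go zero    fuel internal = contradiction internal (out-of-fuel fuel)
    go (suc k) {w} fuel internal with internal? (a₀ ∷ w)
    ... | no  external  = a₀ ∷ w , ∈-tree⁺ (a₀ , w , refl , internal , external) , [ a₀ ] , refl
    ... | yes internal′ with u , u∈ , a₀w≺u ← go k (Fuel-∷ w a₀ fuel) internal′ =
      u , u∈ , ≺-trans ([ a₀ ] , refl) a₀w≺u

  tree-perfectMemory : (∀ {x a} → Internal (x ∷ʳ a) → Internal x) → PerfectMemory tree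
  tree-perfectMemory Internal-∷ʳ⁻ c∈ i with a , x , refl , _ , external ← ∈-tree⁻ c∈ =
    postfix-leaf ((a ∷ x) ∷ʳ i) (external ∘ Internal-∷ʳ⁻)

  ⊑-tree : ∀ {T : Tree n} → (∀ {t} → t ∈ contexts T → ∃₂ λ a x → t ≡ a ∷ x × Internal x) → T ⊑ tree
  ⊑-tree tails {t} t∈ with internal? t
  ... | yes internal = extension-leaf internal
  ... | no  external with a , x , refl , internal ← tails t∈ =
    t , ∈-tree⁺ (a , x , refl , internal , external) , ≺-refl

-- The interior of a context tree

Interior : {n : ℕ} → Tree n → Word n → Set
Interior T x = Any (λ t → ∃ λ b → Infix _≡_ (b ∷ x) t) (contexts T)

module _ {n : ℕ} (T : Tree n) where

  interior? : Decidable (Interior T)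
  interior? x = any? (λ t → Fin.any? (λ b → infix? _≟ᶠ_ (b ∷ x) t)) (contexts T)

  Interior-∷⁻ : ∀ {a x} → Interior T (a ∷ x) → Interior T x
  Interior-∷⁻ {a} = Any.map λ (_ , i) → a , Infix-∷⁻ i

  Interior-∷ʳ⁻ : ∀ {x a} → Interior T (x ∷ʳ a) → Interior T x
  Interior-∷ʳ⁻ = Any.map λ (b , i) → b , Infix-∷ʳ⁻ i

  length≤depth : ∀ {t} → t ∈ contexts T → length t ≤ depth T
  length≤depth = ≤-foldr-⊔ length

  Interior⇒length< : ∀ {x} → Interior T x → length x < depth T
  Interior⇒length< interior with _ , t∈ , _ , i ← find interior = ≤-trans (length-mono i) (length≤depth t∈)

  context-tail-interior : ∀ {b t} → b ∷ t ∈ contexts T → Interior T t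
  context-tail-interior {b} t∈ = lose t∈ (b , fromPointwise (Pointwise.refl refl))

  positive-depth⇒nonempty-context : 0 < depth T → ∃₂ λ b t → b ∷ t ∈ contexts T
  positive-depth⇒nonempty-context deep with foldr-⊔-positive length (contexts T) deep
  ... | b ∷ t , t∈ , _ = b , t , t∈

  Interior⇒occurrence : Complete T → ∀ {a x} → Interior T x → ∃₂ λ p g → p ++ g ∈ contexts T × (a ∷ x) ≺ p
  Interior⇒occurrence complete {a} {x} interior
    with t , t∈ , b , i ← find interior
    with y , g , refl ← Infix⇒∃++ i
    with Complete⇒comparable complete (a ∷ x ++ g)
  ... | u , u∈ , inj₂ (z , refl) = z ++ a ∷ x , g , subst (_∈ _) (sym (++-assoc z (a ∷ x) g)) u∈ , z , refl
  ... | u , u∈ , inj₁ ([] , refl) = a ∷ x , g , u∈ , ≺-refl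
  ... | u , u∈ , inj₁ (c ∷ z , x++g≡) =
    contradiction (++-conicalʳ y (b ∷ z) (++-identityˡ-unique (y ++ b ∷ z) t≡)) λ ()
    where
    u≺t : u ≺ (y ++ b ∷ x ++ g)
    u≺t = y ++ b ∷ z , (begin
      y ++ b ∷ x ++ g   ≡⟨ cong (λ w → y ++ b ∷ w) (∷-injectiveʳ x++g≡) ⟩
      y ++ b ∷ z ++ u   ≡⟨ sym (++-assoc y (b ∷ z) u) ⟩
      (y ++ b ∷ z) ++ u ∎)
      where open ≡-Reasoning
    t≡ : y ++ b ∷ x ++ g ≡ (y ++ b ∷ z) ++ y ++ b ∷ x ++ g
    t≡ = subst (λ v → _ ≡ (y ++ b ∷ z) ++ v) (contexts-antichain T u∈ t∈ u≺t) (proj₂ u≺t)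

module InteriorTree {n : ℕ} (T : Tree n) (deep : 0 < depth T) where

  private
    nonempty : ∃₂ λ b t → b ∷ t ∈ contexts T
    nonempty = positive-depth⇒nonempty-context T deep

    b₀ : Fin n
    b₀ = proj₁ nonempty

    b₀t₀∈ : b₀ ∷ proj₁ (proj₂ nonempty) ∈ contexts T
    b₀t₀∈ = proj₂ (proj₂ nonempty)

    Interior-[] : Interior T []
    Interior-[] = lose b₀t₀∈ (b₀ , here (refl ∷ []))

  open TreeWithInternalNodes (Interior T) (interior? T) (Interior-∷⁻ T) Interior-[]
    (depth T) (Interior⇒length< T) b₀ public

  T⊑tree : T ⊑ tree
  T⊑tree = ⊑-tree {T = T} tails
    where
    tails : ∀ {t} → t ∈ contexts T → ∃₂ λ a x → t ≡ a ∷ x × Interior T x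
    tails {[]} []∈ = contradiction (contexts-antichain T []∈ b₀t₀∈ ([]≺ _)) λ ()
    tails {a ∷ x} t∈ = a , x , refl , context-tail-interior T t∈

  perfectMemory : PerfectMemory tree
  perfectMemory = tree-perfectMemory (Interior-∷ʳ⁻ T)

  covered : Complete T → ∀ {d} → d ∈ contexts tree →
    ∃ λ p → p ∈ nonemptyPrefixes (depth T) (contexts T) × d ≺ p
  covered complete d∈
    with a , x , refl , interior , _ ← ∈-tree⁻ d∈
    with p , g , p++g∈ , ax≺p ← Interior⇒occurrence T complete interior =
    p , ∈-nonemptyPrefixes p++g∈ (length≤depth T p++g∈) (≤-trans (s≤s z≤n) (≺⇒length≤ ax≺p)) , ax≺p

  ⊑tree⇒numLeaves≤ : Complete T → ∀ {C} → C ⊑ tree → numLeaves C ≤ depth T * numLeaves T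
  ⊑tree⇒numLeaves≤ complete {C} C⊑tree = begin
    numLeaves C
      ≤⟨ antichain-length≤ (contexts-unique C) (contexts-antichain C) C-covered ⟩
    length (nonemptyPrefixes (depth T) (contexts T))
      ≡⟨ length-nonemptyPrefixes (depth T) (contexts T) ⟩
    depth T * numLeaves T
      ∎
    where
    open ≤-Reasoning
    C-covered : ∀ {c} → c ∈ contexts C → ∃ λ p → p ∈ nonemptyPrefixes (depth T) (contexts T) × c ≺ p
    C-covered c∈ with d , d∈ , c≺d ← C⊑tree c∈ with p , p∈ , d≺p ← covered complete d∈ =
      p , p∈ , ≺-trans c≺d d≺p

mainTheorem10 : {n : ℕ} (T C : Tree n) → Complete T → 1 ≤ depth T → IsPMClosure T C →
    numLeaves T ≤ numLeaves C × numLeaves C ≤ depth T * numLeaves T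
mainTheorem10 T C complete deep (_ , T⊑C , minimal) =
  numLeaves-mono-⊑ {A = T} {C} T⊑C , ⊑tree⇒numLeaves≤ complete {C} (minimal tree perfectMemory T⊑tree)
  where open InteriorTree T deep
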